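{- For any graph $G$, \[ k(G) \leq \theta_E(E_{\triangle}(G); G) + \max \{ \min \{ 1,|\overline{E}_{\triangle}(G)| \}, |\overline{E}_{\triangle}(G)| - |V(G)| + 2\}. \]
   Context: All graphs are finite, simple and undirected. The competition graph $C(D)$ of a digraph $D$ is the graph with vertex set $V(D)$ in which distinct $x,y$ are adjacent iff there is a vertex $v$ with $(x,v),(y,v)$ both arcs of $D$. The competition number $k(G)$ is the minimum integer $k\ge 0$ such that $G$ together with $k$ new isolated vertices is the competition graph of an acyclic digraph. A clique of $G$ is a vertex subset inducing a complete graph; an edge is covered by a clique if both endpoints lie in it. For $F\subseteq E(G)$, $\theta_E(F;G)$ is the minimum size of a family of cliques of $G$ such that each edge in $F$ is covered by some clique of the family. $E_{\triangle}(G)$ is the set of edges of $G$ contained in some triangle of $G$, and $\overline{E}_{\triangle}(G)=E(G)\setminus E_{\triangle}(G)$. -}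

module Defs where

open import Data.Nat using (ℕ; zero; suc; _+_; _∸_; _⊔_; _⊓_; _≤_; _<_)
open import Data.Bool using (Bool; true; false; T; _∧_; _∨_; not; if_then_else_)
open import Data.Fin using (Fin; toℕ; splitAt; _<?_)
open import Data.Fin.Properties using ()
open import Data.List using (List; length; foldr; map; allFin)
open import Data.Nat.ListAction using (sum)
open import Data.List.Membership.Propositional using (_∈_)
open import Data.Sum using (_⊎_; inj₁; inj₂)
open import Data.Product using (Σ; ∃; _×_; _,_)
open import Data.Empty using (⊥)
open import Relation.Nullary using (¬_)
open import Relation.Nullary.Decidable using (⌊_⌋)
open import Relation.Binary.PropositionalEquality using (_≡_; _≢_)
open import Relation.Binary.Construct.Closure.Transitive using (TransClosure)
open import Function.Bundles using (_⇔_)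

record Graph : Set where
  field
    n     : ℕ
    adj   : Fin n → Fin n → Bool
    sym   : ∀ x y → adj x y ≡ adj y x
    irrefl : ∀ x → adj x x ≡ false

open Graph public

anyFin : ∀ {m} → (Fin m → Bool) → Bool
anyFin {m} p = foldr (λ x b → p x ∨ b) false (allFin m)

Digraph : ℕ → Set
Digraph m = Fin m → Fin m → Bool

Arc : ∀ {m} → Digraph m → Fin m → Fin m → Set
Arc D x y = T (D x y)

Acyclic : ∀ {m} → Digraph m → Set
Acyclic D = ∀ x → ¬ TransClosure (Arc D) x x

IsCompetitionGraphOf : ∀ {m} → (Fin m → Fin m → Bool) → Digraph m → Set
IsCompetitionGraphOf {m} H D =
  ∀ (x y : Fin m) → x ≢ y → (T (H x y) ⇔ ∃ λ v → Arc D x v × Arc D y v)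

-- G together with k new isolated vertices (the new vertices are the last k)
addIsolated : (G : Graph) (k : ℕ) → Fin (n G + k) → Fin (n G + k) → Bool
addIsolated G k x y with splitAt (n G) x | splitAt (n G) y
... | inj₁ a | inj₁ b = adj G a b
... | _      | _      = false

CompetitionRealizable : Graph → ℕ → Set
CompetitionRealizable G k =
  Σ (Digraph (n G + k)) λ D → Acyclic D × IsCompetitionGraphOf (addIsolated G k) D

IsCompetitionNumber : Graph → ℕ → Set
IsCompetitionNumber G k =
  CompetitionRealizable G k × (∀ j → CompetitionRealizable G j → k ≤ j)

VSubset : ℕ → Set
VSubset m = Fin m → Bool

IsClique : (G : Graph) → VSubset (n G) → Set
IsClique G C = ∀ x y → T (C x) → T (C y) → x ≢ y → T (adj G x y)

-- an edge set of G, given as a predicate on ordered pairs (meant to be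
-- applied only to adjacent pairs)
EdgePred : Graph → Set₁
EdgePred G = Fin (n G) → Fin (n G) → Set

CoversEdges : (G : Graph) → EdgePred G → List (VSubset (n G)) → Set
CoversEdges G F fam =
  (∀ C → C ∈ fam → IsClique G C) ×
  (∀ x y → T (adj G x y) → F x y → ∃ λ C → C ∈ fam × T (C x) × T (C y))

IsThetaE : (G : Graph) → EdgePred G → ℕ → Set
IsThetaE G F t =
  (Σ (List (VSubset (n G))) λ fam → CoversEdges G F fam × length fam ≡ t) ×
  (∀ fam → CoversEdges G F fam → t ≤ length fam)

-- x,y have a common neighbour (i.e. xy, if an edge, lies in a triangle)
triB : (G : Graph) → Fin (n G) → Fin (n G) → Bool
triB G x y = anyFin (λ z → adj G x z ∧ adj G y z)

ETriangle : (G : Graph) → EdgePred G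
ETriangle G x y = T (adj G x y ∧ triB G x y)

-- |Ē_△(G)|: number of unordered pairs {x,y} (counted once via toℕ x < toℕ y)
-- that are edges of G lying in no triangle
countEbar : Graph → ℕ
countEbar G = sum (map (λ x → sum (map (λ y → ind x y) (allFin (n G)))) (allFin (n G)))
  where
  ind : Fin (n G) → Fin (n G) → ℕ
  ind x y = if ⌊ x <? y ⌋ ∧ adj G x y ∧ not (triB G x y) then 1 else 0

-- Let t = θ_E(E_△(G); G) with cover C₁ … C_t, n = |V(G)|, and K the
-- second summand.  We realise G ∪ I_{t+K} as the competition graph of an
-- acyclic digraph: the i-th new "clique vertex" is pointed to by the members
-- of Cᵢ, and each of the m edges lying in no triangle gets a private prey,
-- pointed to by exactly its two ends, among the n old and K spare vertices.
-- The private preys come from the prey-assignment lemma (PreyAssignments):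
-- if m ≥ 1, K ≥ 1 and m + 2 ≤ n + K, the handshake bound yields a vertex w of
-- degree ≤ K; its edges take spare vertices as preys (ranked above all old
-- vertices), w becomes a spare vertex itself, and induction on n finishes.
-- Acyclicity is witnessed by a height function that increases along arcs.
module Submission where

open import Level using (Level)
open import Data.Bool using (Bool; true; false; T; _∧_; _∨_; not; if_then_else_)
open import Data.Bool.Properties using (T-∧; T-not-≡; ∧-comm)
open import Data.Empty using (⊥; ⊥-elim)
open import Data.Fin as Fin using (Fin; splitAt; _↑ˡ_; _↑ʳ_; _<?_)
import Data.Fin.Properties as Finₚ
open import Data.List
  using (List; []; _∷_; _++_; length; map; filter; take; drop; zip; concatMap; allFin; lookup)
open import Data.List.Properties
  using (map-cong; foldr-cong; length-map; length-tabulate; length-++; length-take; take++drop≡id;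
         map-++; filter-accept; filter-reject; filter-all)
open import Data.List.Membership.Propositional using (_∈_; _∉_; find; lose)
open import Data.List.Membership.Propositional.Properties
  using (∈-++⁺ˡ; ∈-++⁺ʳ; ∈-++⁻; ∈-map⁺; ∈-map⁻; ∈-filter⁺; ∈-filter⁻;
         ∈-concatMap⁺; ∈-concatMap⁻; ∈-allFin; ∈-lookup)
open import Data.List.Relation.Binary.Disjoint.Propositional using (Disjoint)
open import Data.List.Relation.Unary.All as All using (All; []; _∷_)
open import Data.List.Relation.Unary.All.Properties using (¬Any⇒All¬)
open import Data.List.Relation.Unary.AllPairs using ([]; _∷_)
open import Data.List.Relation.Unary.Any as Any using (Any; here; there; any?)
import Data.List.Relation.Unary.Any.Properties as Anyₚ
open import Data.List.Relation.Unary.Unique.Propositional using (Unique)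
import Data.List.Relation.Unary.Unique.Propositional.Properties as Unique
open import Data.Nat using (ℕ; zero; suc; _+_; _*_; _∸_; _⊓_; _⊔_; _≤_; _<_; _≤?_; z≤n; s≤s)
open import Data.Nat.ListAction using (sum)
open import Data.Nat.Properties hiding (_<?_; _≟_)
open import Algebra.Properties.CommutativeSemigroup +-commutativeSemigroup using (x∙yz≈y∙xz)
open import Data.Nat.Tactic.RingSolver using (solve-∀)
import Data.Product as Product
open import Data.Product using (∃; ∃₂; _×_; _,_; proj₁; proj₂)
open import Data.Sum using (_⊎_; inj₁; inj₂)
open import Data.Unit using (tt)
open import Function using (id; _∘_)
open import Function.Bundles using (Equivalence; mk⇔)
open import Relation.Binary.Construct.Closure.Transitive using (TransClosure; [_]; _∷_)
open import Relation.Binary.Definitions using (DecidableEquality; tri<; tri≈; tri>)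
open import Relation.Binary.PropositionalEquality
  using (_≡_; _≢_; refl; sym; trans; cong; cong₂; subst; subst₂)
open import Relation.Nullary using (¬_; Dec; yes; no; does; ¬?; contradiction)
open import Relation.Nullary.Decidable using (⌊_⌋; toWitness; fromWitness; _⊎-dec_; _×-dec_; T?)
open import Relation.Unary using (Pred; Decidable)
open import Relation.Unary.Properties using (∁?)

open import Defs hiding (sym)

module ListFacts {A : Set} where

  ∈⇒≤sum : (f : A → ℕ) {x : A} {xs : List A} → x ∈ xs → f x ≤ sum (map f xs)
  ∈⇒≤sum f {xs = y ∷ ys} (here refl)   = m≤m+n (f y) (sum (map f ys))
  ∈⇒≤sum f {xs = y ∷ ys} (there x∈ys) = ≤-trans (∈⇒≤sum f x∈ys) (m≤n+m _ (f y))

  sum-lower : (f : A → ℕ) (c : ℕ) {xs : List A} →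
              All (λ x → c ≤ f x) xs → length xs * c ≤ sum (map f xs)
  sum-lower f c []            = z≤n
  sum-lower f c (c≤fx ∷ rest) = +-mono-≤ c≤fx (sum-lower f c rest)

  two-members : {x y : A} {xs : List A} → x ∈ xs → y ∈ xs → x ≢ y → 2 ≤ length xs
  two-members {xs = _ ∷ _ ∷ _} _           _           _   = s≤s (s≤s z≤n)
  two-members {xs = _ ∷ []}    (here refl) (here refl) x≢y = contradiction refl x≢y

  no-three-in-pair : {x y a b c : A} → a ≢ b → a ≢ c → b ≢ c →
                     a ≡ x ⊎ a ≡ y → b ≡ x ⊎ b ≡ y → c ≡ x ⊎ c ≡ y → ⊥
  no-three-in-pair a≢b _   _   (inj₁ refl) (inj₁ refl) _           = a≢b refl
  no-three-in-pair _   a≢c _   (inj₁ refl) (inj₂ refl) (inj₁ refl) = a≢c refl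
  no-three-in-pair _   _   b≢c (inj₁ refl) (inj₂ refl) (inj₂ refl) = b≢c refl
  no-three-in-pair _   _   b≢c (inj₂ refl) (inj₁ refl) (inj₁ refl) = b≢c refl
  no-three-in-pair _   a≢c _   (inj₂ refl) (inj₁ refl) (inj₂ refl) = a≢c refl
  no-three-in-pair a≢b _   _   (inj₂ refl) (inj₂ refl) _           = a≢b refl

  unique-in-pair : {x y : A} {zs : List A} → Unique zs →
                   (∀ {v} → v ∈ zs → v ≡ x ⊎ v ≡ y) → length zs ≤ 2
  unique-in-pair {zs = []}         _ _ = z≤n
  unique-in-pair {zs = _ ∷ []}     _ _ = s≤s z≤n
  unique-in-pair {zs = _ ∷ _ ∷ []} _ _ = s≤s (s≤s z≤n)
  unique-in-pair {zs = _ ∷ _ ∷ _ ∷ _} ((a≢b ∷ a≢c ∷ _) ∷ (b≢c ∷ _) ∷ _) in-pair =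
    ⊥-elim (no-three-in-pair a≢b a≢c b≢c (in-pair (here refl)) (in-pair (there (here refl)))
                                         (in-pair (there (there (here refl)))))

  unique-++-disjoint : (xs : List A) {ys : List A} → Unique (xs ++ ys) → Disjoint xs ys
  unique-++-disjoint (x ∷ xs) (x≢rest ∷ _) (here refl , x∈ys) =
    All.lookup x≢rest (∈-++⁺ʳ xs x∈ys) refl
  unique-++-disjoint (x ∷ xs) (_ ∷ rest) (there v∈xs , v∈ys) =
    unique-++-disjoint xs rest (v∈xs , v∈ys)

  unique-map-injective : {B : Set} (f : A → B) {xs : List A} {x y : A} →
                         Unique (map f xs) → x ∈ xs → y ∈ xs → f x ≡ f y → x ≡ y
  unique-map-injective f _ (here refl) (here refl) _ = refl
  unique-map-injective f (fx≢ ∷ _) (here refl) (there y∈xs) fx≡fy =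
    ⊥-elim (All.lookup fx≢ (∈-map⁺ f y∈xs) fx≡fy)
  unique-map-injective f (fy≢ ∷ _) (there x∈xs) (here refl) fx≡fy =
    ⊥-elim (All.lookup fy≢ (∈-map⁺ f x∈xs) (sym fx≡fy))
  unique-map-injective f (_ ∷ rest) (there x∈xs) (there y∈xs) fx≡fy =
    unique-map-injective f rest x∈xs y∈xs fx≡fy

  length-filter-split : {ℓ : Level} {P : Pred A ℓ} (P? : Decidable P) (xs : List A) →
                        length xs ≡ length (filter P? xs) + length (filter (∁? P?) xs)
  length-filter-split P? [] = refl
  length-filter-split P? (x ∷ xs) with does (P? x)
  ... | true  = cong suc (length-filter-split P? xs)
  ... | false = trans (cong suc (length-filter-split P? xs)) (sym (+-suc _ _))

  length-remove : (_≟_ : DecidableEquality A) {w : A} {xs : List A} → Unique xs → w ∈ xs →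
                  length xs ≡ suc (length (filter (λ v → ¬? (v ≟ w)) xs))
  length-remove _≟_ {xs = x ∷ xs} (x≢rest ∷ _) (here refl) =
    cong suc (cong length (sym (trans (filter-reject (λ v → ¬? (v ≟ x)) (λ x≢x → x≢x refl))
                                      (filter-all (λ v → ¬? (v ≟ x)) x∉rest))))
    where
    x∉rest : All (λ v → ¬ v ≡ x) xs
    x∉rest = All.map (λ x≢v v≡x → x≢v (sym v≡x)) x≢rest
  length-remove _≟_ {w} {x ∷ xs} (x≢rest ∷ rest) (there w∈xs) =
    trans (cong suc (length-remove _≟_ rest w∈xs))
          (cong (λ ys → suc (length ys))
                (sym (filter-accept (λ v → ¬? (v ≟ w)) (All.lookup x≢rest w∈xs))))

  length-concatMap : {B : Set} (f : A → List B) (xs : List A) →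
                     length (concatMap f xs) ≡ sum (map (λ x → length (f x)) xs)
  length-concatMap f []       = refl
  length-concatMap f (x ∷ xs) =
    trans (length-++ (f x)) (cong (length (f x) +_) (length-concatMap f xs))

module ZipFacts {A B : Set} where

  zip-∈ : {as : List A} {bs : List B} {a : A} {b : B} →
          (a , b) ∈ zip as bs → a ∈ as × b ∈ bs
  zip-∈ {_ ∷ _} {_ ∷ _} (here refl) = here refl , here refl
  zip-∈ {_ ∷ _} {_ ∷ _} (there p∈)  = let (a∈ , b∈) = zip-∈ p∈ in there a∈ , there b∈

  zip-complete : {as : List A} {bs : List B} {a : A} →
                 length as ≤ length bs → a ∈ as → ∃ λ b → (a , b) ∈ zip as bs
  zip-complete {_ ∷ _} {b ∷ _} _          (here refl) = b , here refl
  zip-complete {_ ∷ _} {_ ∷ _} (s≤s len≤) (there a∈)  =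
    let (b , p∈) = zip-complete len≤ a∈ in b , there p∈

  map-proj₂-zip : {as : List A} {bs : List B} → length as ≡ length bs → map proj₂ (zip as bs) ≡ bs
  map-proj₂-zip {[]}    {[]}    _  = refl
  map-proj₂-zip {_ ∷ _} {_ ∷ _} eq = cong (_ ∷_) (map-proj₂-zip (suc-injective eq))

-- Arithmetic core of the low-degree argument: if v ≥ 2, x ≥ 1 and
-- l + 2 ≤ v + x, then v vertices of degree > x need more than 2·l edge ends.
slots-arith : ∀ {v x l} → 2 ≤ v → 1 ≤ x → v * suc x ≤ 2 * l → l + 2 ≤ v + x → ⊥
slots-arith {suc (suc a)} {suc b} {l} (s≤s (s≤s z≤n)) (s≤s z≤n) many few =
  <-irrefl refl (begin-strict
    2 * (a + suc b)                     <⟨ s≤s (m≤m+n _ (suc (a * b))) ⟩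
    suc (2 * (a + suc b)) + suc (a * b) ≡⟨ expand a b ⟨
    suc (suc a) * suc (suc b)           ≤⟨ many ⟩
    2 * l                               ≤⟨ *-monoʳ-≤ 2 l≤ ⟩
    2 * (a + suc b)                     ∎)
  where
  open ≤-Reasoning
  expand : ∀ a b → suc (suc a) * suc (suc b) ≡ suc (2 * (a + suc b)) + suc (a * b)
  expand = solve-∀
  reassociate : ∀ a b → suc (suc a) + suc b ≡ (a + suc b) + 2
  reassociate = solve-∀
  l≤ : l ≤ a + suc b
  l≤ = +-cancelʳ-≤ 2 l (a + suc b) (subst (l + 2 ≤_) (reassociate a b) few)

regroup : ∀ d l r {s} → s ≡ l + r → d + s ≡ l + (d + r)
regroup d l r refl = x∙yz≈y∙xz d l r

-- Arithmetic of one elimination step: retiring a vertex of degree d.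
retire-arith : ∀ d l v x → d + l + 2 ≤ suc v + (d + x) → l + 2 ≤ v + suc x
retire-arith d l v x h = +-cancelˡ-≤ d (l + 2) (v + suc x) (subst₂ _≤_ (lhs d l) (rhs d v x) h)
  where
  lhs : ∀ d l → d + l + 2 ≡ d + (l + 2)
  lhs = solve-∀
  rhs : ∀ d v x → suc v + (d + x) ≡ d + (v + suc x)
  rhs = solve-∀

module PreyAssignments {A : Set} (_≟_ : DecidableEquality A) where

  open ListFacts
  open ZipFacts
  open import Data.List.Membership.DecPropositional _≟_ using (_∈?_)

  Edge : Set
  Edge = A × A

  Incident : A → Edge → Set
  Incident u e = u ≡ proj₁ e ⊎ u ≡ proj₂ e

  incident? : (u : A) → Decidable (Incident u)
  incident? u e = (u ≟ proj₁ e) ⊎-dec (u ≟ proj₂ e)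

  degree : A → List Edge → ℕ
  degree u L = length (filter (incident? u) L)

  ends-in : Edge → List A → ℕ
  ends-in e V = length (filter (λ v → incident? v e) V)

  degree-sum : List A → List Edge → ℕ
  degree-sum V L = sum (map (λ v → degree v L) V)

  degree-sum-cons : (e : Edge) (L : List Edge) (V : List A) →
                    degree-sum V (e ∷ L) ≡ ends-in e V + degree-sum V L
  degree-sum-cons e L [] = refl
  degree-sum-cons e L (v ∷ V) with does (incident? v e)
  ... | true  = cong suc (regroup (degree v L) (ends-in e V) (degree-sum V L) (degree-sum-cons e L V))
  ... | false = regroup (degree v L) (ends-in e V) (degree-sum V L) (degree-sum-cons e L V)

  ends-in≤2 : {V : List A} (e : Edge) → Unique V → ends-in e V ≤ 2
  ends-in≤2 {V} e V! = unique-in-pair (Unique.filter⁺ (λ v → incident? v e) V!)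
                                      (λ v∈ → proj₂ (∈-filter⁻ (λ v → incident? v e) {xs = V} v∈))

  handshake : {V : List A} → Unique V → (L : List Edge) → degree-sum V L ≤ 2 * length L
  handshake {V} V! [] = ≤-reflexive (no-degree V)
    where
    no-degree : ∀ V → degree-sum V [] ≡ 0
    no-degree []      = refl
    no-degree (_ ∷ V) = no-degree V
  handshake {V} V! (e ∷ L) = begin
    degree-sum V (e ∷ L)          ≡⟨ degree-sum-cons e L V ⟩
    ends-in e V + degree-sum V L  ≤⟨ +-mono-≤ (ends-in≤2 e V!) (handshake V! L) ⟩
    2 + 2 * length L              ≡⟨ *-suc 2 (length L) ⟨
    2 * length (e ∷ L)            ∎
    where open ≤-Reasoning

  -- An instance: vertices V, spare vertices X (usable only as preys), and
  -- loopless edges L on V; `room` is the counting condition of the theorem.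
  record Admissible (V X : List A) (L : List Edge) : Set where
    field
      V-unique  : Unique V
      X-unique  : Unique X
      V#X       : Disjoint V X
      ends-in-V : ∀ {u e} → e ∈ L → Incident u e → u ∈ V
      loopless  : ∀ {e} → e ∈ L → proj₁ e ≢ proj₂ e
      room      : 0 < length L → 1 ≤ length X × length L + 2 ≤ length V + length X

  record PreyAssignment (V X : List A) (L : List Edge) : Set where
    field
      assignment     : List (Edge × A)
      rank           : A → ℕ
      preys-unique   : Unique (map proj₂ assignment)
      edge-in-L      : ∀ {e z} → (e , z) ∈ assignment → e ∈ L
      prey-available : ∀ {e z} → (e , z) ∈ assignment → z ∈ V ++ X
      edge-has-prey  : ∀ {e} → e ∈ L → ∃ λ z → (e , z) ∈ assignment
      rank-increases : ∀ {u e z} → (e , z) ∈ assignment → Incident u e → rank u < rank z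

  no-edges : {V X : List A} → PreyAssignment V X []
  no-edges = record
    { assignment = [] ; rank = λ _ → 0 ; preys-unique = []
    ; edge-in-L = λ () ; prey-available = λ () ; edge-has-prey = λ () ; rank-increases = λ () }

  -- If every degree exceeded |X|, the handshake bound would contradict `room`;
  -- hence some vertex has at most |X| incident edges.
  low-degree-vertex : {V X : List A} {L : List Edge} {e : Edge} → Admissible V X L → e ∈ L →
                      1 ≤ length X → length L + 2 ≤ length V + length X →
                      ∃ λ w → w ∈ V × degree w L ≤ length X
  low-degree-vertex {V} {X} {L} adm e∈L X≥1 few with any? (λ v → degree v L ≤? length X) V
  ... | yes found = find found
  ... | no none   = ⊥-elim (slots-arith V≥2 X≥1 many few)
    where
    open Admissible adm
    V≥2 : 2 ≤ length V
    V≥2 = two-members (ends-in-V e∈L (inj₁ refl)) (ends-in-V e∈L (inj₂ refl)) (loopless e∈L)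
    many : length V * suc (length X) ≤ 2 * length L
    many = ≤-trans (sum-lower (λ v → degree v L) (suc (length X)) (All.map ≰⇒> (¬Any⇒All¬ V none)))
                   (handshake V-unique L)

  -- The d edges Lw at w take the
  -- preys Xu, ranked above all of V.
  module Step {V X : List A} {L : List Edge} (adm : Admissible V X L)
              {w : A} (w∈V : w ∈ V) (low : degree w L ≤ length X)
              (few : length L + 2 ≤ length V + length X) where
    open Admissible adm

    d : ℕ
    d = degree w L

    Lw L' : List Edge
    Lw = filter (incident? w) L
    L' = filter (∁? (incident? w)) L

    Xu Xr X' V' : List A
    Xu = take d X
    Xr = drop d X
    X' = w ∷ Xr
    V' = filter (λ v → ¬? (v ≟ w)) V

    ∈V'⁻ : ∀ {v} → v ∈ V' → v ∈ V × v ≢ w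
    ∈V'⁻ = ∈-filter⁻ (λ v → ¬? (v ≟ w)) {xs = V}

    ∈Lw⁻ : ∀ {e} → e ∈ Lw → e ∈ L × Incident w e
    ∈Lw⁻ = ∈-filter⁻ (incident? w) {xs = L}

    ∈L'⁻ : ∀ {e} → e ∈ L' → e ∈ L × ¬ Incident w e
    ∈L'⁻ = ∈-filter⁻ (∁? (incident? w)) {xs = L}

    Xu++Xr≡X : Xu ++ Xr ≡ X
    Xu++Xr≡X = take++drop≡id d X

    length-Xu : length Xu ≡ d
    length-Xu = trans (length-take d X) (m≤n⇒m⊓n≡m low)

    length-V : length V ≡ suc (length V')
    length-V = length-remove _≟_ V-unique w∈V

    V'⊆V : ∀ {v} → v ∈ V' → v ∈ V
    V'⊆V v∈V' = proj₁ (∈V'⁻ v∈V')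

    w∉V' : w ∉ V'
    w∉V' w∈V' = proj₂ (∈V'⁻ w∈V') refl

    Xu⊆X : ∀ {v} → v ∈ Xu → v ∈ X
    Xu⊆X v∈Xu = subst (_ ∈_) Xu++Xr≡X (∈-++⁺ˡ v∈Xu)

    Xr⊆X : ∀ {v} → v ∈ Xr → v ∈ X
    Xr⊆X v∈Xr = subst (_ ∈_) Xu++Xr≡X (∈-++⁺ʳ Xu v∈Xr)

    V∉Xu : ∀ {v} → v ∈ V → v ∉ Xu
    V∉Xu v∈V v∈Xu = V#X (v∈V , Xu⊆X v∈Xu)

    V'X'∉Xu : ∀ {v} → v ∈ V' ++ X' → v ∉ Xu
    V'X'∉Xu v∈ with ∈-++⁻ V' v∈
    ... | inj₁ v∈V'         = V∉Xu (V'⊆V v∈V')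
    ... | inj₂ (here refl)  = V∉Xu w∈V
    ... | inj₂ (there v∈Xr) = λ v∈Xu →
      unique-++-disjoint Xu (subst Unique (sym Xu++Xr≡X) X-unique) (v∈Xu , v∈Xr)

    V'X'⊆VX : ∀ {v} → v ∈ V' ++ X' → v ∈ V ++ X
    V'X'⊆VX v∈ with ∈-++⁻ V' v∈
    ... | inj₁ v∈V'         = ∈-++⁺ˡ (V'⊆V v∈V')
    ... | inj₂ (here refl)  = ∈-++⁺ˡ w∈V
    ... | inj₂ (there v∈Xr) = ∈-++⁺ʳ V (Xr⊆X v∈Xr)

    ends-in-V' : ∀ {u e} → e ∈ L' → Incident u e → u ∈ V'
    ends-in-V' e∈L' u∈e =
      let (e∈L , w∉e) = ∈L'⁻ e∈L' in
      ∈-filter⁺ (λ v → ¬? (v ≟ w)) (ends-in-V e∈L u∈e) (λ { refl → w∉e u∈e })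

    -- dropping w and its d edges while trading d spare vertices for w keeps room
    room' : length L' + 2 ≤ length V' + length X'
    room' = retire-arith d (length L') (length V') (length Xr)
              (subst₂ _≤_ (cong (_+ 2) (length-filter-split (incident? w) L))
                          (cong₂ _+_ length-V length-X) few)
      where
      length-X : length X ≡ d + length Xr
      length-X = trans (cong length (sym Xu++Xr≡X))
                       (trans (length-++ Xu) (cong (_+ length Xr) length-Xu))

    smaller : Admissible V' X' L'
    smaller = record
      { V-unique  = Unique.filter⁺ (λ v → ¬? (v ≟ w)) V-unique
      ; X-unique  = ¬Any⇒All¬ Xr w∉Xr ∷ Unique.drop⁺ d X-unique
      ; V#X       = λ { (v∈V' , here refl)  → w∉V' v∈V'
                      ; (v∈V' , there v∈Xr) → V#X (V'⊆V v∈V' , Xr⊆X v∈Xr) }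
      ; ends-in-V = ends-in-V'
      ; loopless  = λ e∈L' → loopless (proj₁ (∈L'⁻ e∈L'))
      ; room      = λ _ → s≤s z≤n , room'
      }
      where
      w∉Xr : w ∉ Xr
      w∉Xr w∈Xr = V#X (w∈V , Xr⊆X w∈Xr)

    module Extend (S' : PreyAssignment V' X' L') where
      module S' = PreyAssignment S'

      assignment : List (Edge × A)
      assignment = S'.assignment ++ zip Lw Xu

      top : ℕ
      top = suc (sum (map S'.rank V))

      rank : A → ℕ
      rank v with v ∈? Xu
      ... | yes _ = top
      ... | no _  = S'.rank v

      rank-new : ∀ {v} → v ∈ Xu → rank v ≡ top
      rank-new {v} v∈Xu with v ∈? Xu
      ... | yes _   = refl
      ... | no v∉Xu = contradiction v∈Xu v∉Xu

      rank-old : ∀ {v} → v ∉ Xu → rank v ≡ S'.rank v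
      rank-old {v} v∉Xu with v ∈? Xu
      ... | yes v∈Xu = contradiction v∈Xu v∉Xu
      ... | no _     = refl

      preys≡ : map proj₂ assignment ≡ map proj₂ S'.assignment ++ Xu
      preys≡ = trans (map-++ proj₂ S'.assignment (zip Lw Xu))
                     (cong (map proj₂ S'.assignment ++_) (map-proj₂-zip (sym length-Xu)))

      old#new : Disjoint (map proj₂ S'.assignment) Xu
      old#new (z∈ , z∈Xu) with ∈-map⁻ proj₂ z∈
      ... | _ , p∈ , refl = V'X'∉Xu (S'.prey-available p∈) z∈Xu

      preys-unique : Unique (map proj₂ assignment)
      preys-unique = subst Unique (sym preys≡)
                       (Unique.++⁺ S'.preys-unique (Unique.take⁺ d X-unique) old#new)

      edge-in-L : ∀ {e z} → (e , z) ∈ assignment → e ∈ L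
      edge-in-L p∈ with ∈-++⁻ S'.assignment p∈
      ... | inj₁ old = proj₁ (∈L'⁻ (S'.edge-in-L old))
      ... | inj₂ new = proj₁ (∈Lw⁻ (proj₁ (zip-∈ new)))

      prey-available : ∀ {e z} → (e , z) ∈ assignment → z ∈ V ++ X
      prey-available p∈ with ∈-++⁻ S'.assignment p∈
      ... | inj₁ old = V'X'⊆VX (S'.prey-available old)
      ... | inj₂ new = ∈-++⁺ʳ V (Xu⊆X (proj₂ (zip-∈ new)))

      edge-has-prey : ∀ {e} → e ∈ L → ∃ λ z → (e , z) ∈ assignment
      edge-has-prey {e} e∈L with incident? w e
      ... | yes w∈e = let (z , p∈) = zip-complete (≤-reflexive (sym length-Xu))
                                                  (∈-filter⁺ (incident? w) e∈L w∈e)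
                      in z , ∈-++⁺ʳ S'.assignment p∈
      ... | no w∉e  = let (z , p∈) = S'.edge-has-prey (∈-filter⁺ (∁? (incident? w)) e∈L w∉e)
                      in z , ∈-++⁺ˡ p∈

      rank-increases : ∀ {u e z} → (e , z) ∈ assignment → Incident u e → rank u < rank z
      rank-increases p∈ u∈e with ∈-++⁻ S'.assignment p∈
      ... | inj₁ old = subst₂ _<_ (sym (rank-old (V'X'∉Xu (∈-++⁺ˡ u∈V'))))
                                  (sym (rank-old (V'X'∉Xu (S'.prey-available old))))
                                  (S'.rank-increases old u∈e)
        where
        u∈V' : _ ∈ V'
        u∈V' = ends-in-V' (S'.edge-in-L old) u∈e
      ... | inj₂ new = subst₂ _<_ (sym (rank-old (V∉Xu u∈V))) (sym (rank-new (proj₂ (zip-∈ new))))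
                                  (s≤s (∈⇒≤sum S'.rank u∈V))
        where
        u∈V : _ ∈ V
        u∈V = ends-in-V (proj₁ (∈Lw⁻ (proj₁ (zip-∈ new)))) u∈e

      extended : PreyAssignment V X L
      extended = record
        { assignment = assignment ; rank = rank ; preys-unique = preys-unique
        ; edge-in-L = edge-in-L ; prey-available = prey-available
        ; edge-has-prey = edge-has-prey ; rank-increases = rank-increases }

  assign : ∀ k {V X : List A} {L : List Edge} → length V ≡ k → Admissible V X L →
           PreyAssignment V X L
  assign _ {L = []} _ _ = no-edges
  assign zero {V = []} {L = e ∷ _} _ adm with Admissible.ends-in-V adm (here refl) (inj₁ refl)
  ... | ()
  assign (suc k) {L = e ∷ _} |V|≡ adm
    with X≥1 , few ← Admissible.room adm (s≤s z≤n)
    with w , w∈V , low ← low-degree-vertex adm (here refl) X≥1 few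
    = let open Step adm w∈V low few
      in Extend.extended (assign k (suc-injective (trans (sym length-V) |V|≡)) smaller)

  prey-assignment : {V X : List A} {L : List Edge} → Admissible V X L → PreyAssignment V X L
  prey-assignment = assign _ refl

ranked⇒acyclic : ∀ {m} (D : Digraph m) (height : Fin m → ℕ) →
                 (∀ {x y} → Arc D x y → height x < height y) → Acyclic D
ranked⇒acyclic D height climbs x cycle = <-irrefl refl (along cycle)
  where
  along : ∀ {x y} → TransClosure (Arc D) x y → height x < height y
  along [ xy ]      = climbs xy
  along (xy ∷ rest) = <-trans (climbs xy) (along rest)

↑ˡ≢↑ʳ : ∀ {m n} (a : Fin m) (j : Fin n) → a ↑ˡ n ≢ m ↑ʳ j
↑ˡ≢↑ʳ {m} {n} a j eq
  with () ← trans (sym (Finₚ.splitAt-↑ˡ m a n)) (trans (cong (splitAt m) eq) (Finₚ.splitAt-↑ʳ m n j))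

addIsolated-↑ˡ : (G : Graph) (k : ℕ) (a b : Fin (n G)) →
                 addIsolated G k (a ↑ˡ k) (b ↑ˡ k) ≡ adj G a b
addIsolated-↑ˡ G k a b rewrite Finₚ.splitAt-↑ˡ (n G) a k | Finₚ.splitAt-↑ˡ (n G) b k = refl

addIsolated-edge : (G : Graph) (k : ℕ) (x y : Fin (n G + k)) → T (addIsolated G k x y) →
                   ∃₂ λ a b → x ≡ a ↑ˡ k × y ≡ b ↑ˡ k × T (adj G a b)
addIsolated-edge G k x y xy with splitAt (n G) x in x≡ | splitAt (n G) y in y≡
... | inj₁ a | inj₁ b = a , b , sym (Finₚ.splitAt⁻¹-↑ˡ x≡) , sym (Finₚ.splitAt⁻¹-↑ˡ y≡) , xy

triB-sym : (G : Graph) (x y : Fin (n G)) → triB G x y ≡ triB G y x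
triB-sym G x y =
  foldr-cong (λ z b → cong (_∨ b) (∧-comm (adj G x z) (adj G y z))) refl (allFin (n G))

module NonTriangleEdges (G : Graph) where

  nonTriangle : Fin (n G) → Fin (n G) → Bool
  nonTriangle x y = ⌊ x <? y ⌋ ∧ adj G x y ∧ not (triB G x y)

  candidate : Fin (n G) → Fin (n G) → List (Fin (n G) × Fin (n G))
  candidate x y = if nonTriangle x y then (x , y) ∷ [] else []

  in-triangle : ∀ {x y} → T (adj G x y) → triB G x y ≡ true → ETriangle G x y
  in-triangle {x} {y} xy triangle = Equivalence.from (T-∧ {adj G x y}) (xy , subst T (sym triangle) tt)

  Ebar : List (Fin (n G) × Fin (n G))
  Ebar = concatMap (λ x → concatMap (candidate x) (allFin (n G))) (allFin (n G))

  length-Ebar : length Ebar ≡ countEbar G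
  length-Ebar = trans (ListFacts.length-concatMap _ (allFin (n G)))
    (cong sum (map-cong (λ x → trans (ListFacts.length-concatMap (candidate x) (allFin (n G)))
                                     (cong sum (map-cong (length-candidate x) (allFin (n G)))))
                        (allFin (n G))))
    where
    length-candidate : ∀ x y → length (candidate x y) ≡ (if nonTriangle x y then 1 else 0)
    length-candidate x y with nonTriangle x y
    ... | true  = refl
    ... | false = refl

  nonTriangle-adj : ∀ {x y} → T (nonTriangle x y) → T (adj G x y)
  nonTriangle-adj {x} {y} =
    proj₁ ∘ Equivalence.to (T-∧ {adj G x y}) ∘ proj₂ ∘ Equivalence.to (T-∧ {⌊ x <? y ⌋})

  nonTriangle-intro : ∀ {x y} → x Fin.< y → T (adj G x y) → triB G x y ≡ false →
                      T (nonTriangle x y)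
  nonTriangle-intro {x} {y} x<y xy no-triangle =
    Equivalence.from (T-∧ {⌊ x <? y ⌋}) (fromWitness x<y ,
      Equivalence.from (T-∧ {adj G x y}) (xy , Equivalence.from T-not-≡ no-triangle))

  candidate⁻ : ∀ {x y p} → p ∈ candidate x y → T (nonTriangle x y) × p ≡ (x , y)
  candidate⁻ {x} {y} p∈ with nonTriangle x y
  candidate⁻ (here refl) | true = tt , refl

  candidate⁺ : ∀ {x y} → T (nonTriangle x y) → (x , y) ∈ candidate x y
  candidate⁺ {x} {y} h with nonTriangle x y
  ... | true  = here refl
  ... | false = ⊥-elim h

  Ebar⁻ : ∀ {p} → p ∈ Ebar → ∃₂ λ x y → T (nonTriangle x y) × p ≡ (x , y)
  Ebar⁻ p∈
    with x , _ , p∈x  ← find (∈-concatMap⁻ (λ x → concatMap (candidate x) (allFin (n G)))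
                                          {xs = allFin (n G)} p∈)
    with y , _ , p∈xy ← find (∈-concatMap⁻ (candidate x) {xs = allFin (n G)} p∈x)
    = x , y , candidate⁻ p∈xy

  Ebar⁺ : ∀ {x y} → T (nonTriangle x y) → (x , y) ∈ Ebar
  Ebar⁺ {x} {y} h = ∈-concatMap⁺ _ (lose (∈-allFin x)
                      (∈-concatMap⁺ (candidate x) (lose (∈-allFin y) (candidate⁺ h))))

  Ebar-complete : ∀ {x y} → T (adj G x y) → triB G x y ≡ false → (x , y) ∈ Ebar ⊎ (y , x) ∈ Ebar
  Ebar-complete {x} {y} xy no-triangle with Finₚ.<-cmp x y
  ... | tri< x<y _ _  = inj₁ (Ebar⁺ (nonTriangle-intro x<y xy no-triangle))
  ... | tri≈ _ refl _ = ⊥-elim (subst T (irrefl G x) xy)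
  ... | tri> _ _ y<x  = inj₂ (Ebar⁺ (nonTriangle-intro y<x (subst T (Graph.sym G x y) xy)
                                                          (trans (triB-sym G y x) no-triangle)))

module Realization (G : Graph) (fam : List (VSubset (n G)))
                   (cover : CoversEdges G (ETriangle G) fam) (K : ℕ)
                   (room : 0 < countEbar G → 1 ≤ K × countEbar G + 2 ≤ n G + K) where

  open NonTriangleEdges G

  t N : ℕ
  t = length fam
  N = n G + (t + K)

  old : Fin (n G) → Fin N
  old a = a ↑ˡ (t + K)

  clique : Fin t → Fin N
  clique i = n G ↑ʳ (i ↑ˡ K)

  spare : Fin K → Fin N
  spare j = n G ↑ʳ (t ↑ʳ j)

  open PreyAssignments (Finₚ._≟_ {N})
  open ListFacts using (∈⇒≤sum; unique-map-injective)
  open import Data.List.Membership.DecPropositional (Finₚ._≟_ {N}) using (_∈?_)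

  V X : List (Fin N)
  V = map old (allFin (n G))
  X = map spare (allFin K)

  L : List Edge
  L = map (Product.map old old) Ebar

  old∈V : ∀ a → old a ∈ V
  old∈V a = ∈-map⁺ old (∈-allFin a)

  L⁻ : ∀ {e} → e ∈ L → ∃₂ λ a b → T (adj G a b) × e ≡ (old a , old b)
  L⁻ e∈L with _ , p∈ , refl ← ∈-map⁻ (Product.map old old) e∈L
         with a , b , ab , refl ← Ebar⁻ p∈
         = a , b , nonTriangle-adj ab , refl

  -- clique vertices are neither old nor spare, so never preys of edges
  clique∉VX : ∀ i → clique i ∉ V ++ X
  clique∉VX i c∈ with ∈-++⁻ V c∈
  ... | inj₁ c∈V with a , _ , c≡ ← ∈-map⁻ old c∈V = ↑ˡ≢↑ʳ a (i ↑ˡ K) (sym c≡)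
  ... | inj₂ c∈X with j , _ , c≡ ← ∈-map⁻ spare c∈X =
    ↑ˡ≢↑ʳ i j (Finₚ.↑ʳ-injective (n G) _ _ c≡)

  V#X : Disjoint V X
  V#X (v∈V , v∈X) with a , _ , refl ← ∈-map⁻ old v∈V | j , _ , v≡ ← ∈-map⁻ spare v∈X
    = ↑ˡ≢↑ʳ a (t ↑ʳ j) v≡

  ends-in-V : ∀ {u e} → e ∈ L → Incident u e → u ∈ V
  ends-in-V e∈L u∈e with L⁻ e∈L
  ends-in-V _ (inj₁ refl) | a , _ , _ , refl = old∈V a
  ends-in-V _ (inj₂ refl) | _ , b , _ , refl = old∈V b

  loopless : ∀ {e} → e ∈ L → proj₁ e ≢ proj₂ e
  loopless e∈L old-a≡old-b with a , b , ab , refl ← L⁻ e∈L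
    with refl ← Finₚ.↑ˡ-injective (t + K) a b old-a≡old-b
    = subst T (irrefl G a) ab

  length-V : length V ≡ n G
  length-V = trans (length-map old (allFin (n G))) (length-tabulate id)

  length-X : length X ≡ K
  length-X = trans (length-map spare (allFin K)) (length-tabulate id)

  length-L : length L ≡ countEbar G
  length-L = trans (length-map _ Ebar) length-Ebar

  admissible : Admissible V X L
  admissible = record
    { V-unique  = Unique.map⁺ (Finₚ.↑ˡ-injective (t + K) _ _) (Unique.allFin⁺ (n G))
    ; X-unique  = Unique.map⁺ (Finₚ.↑ʳ-injective t _ _ ∘ Finₚ.↑ʳ-injective (n G) _ _)
                              (Unique.allFin⁺ K)
    ; V#X       = V#X
    ; ends-in-V = ends-in-V
    ; loopless  = loopless
    ; room      = λ L≢[] → let (K≥1 , few) = room (subst (0 <_) length-L L≢[])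
                           in subst (1 ≤_) (sym length-X) K≥1
                            , subst₂ _≤_ (cong (_+ 2) (sym length-L))
                                         (sym (cong₂ _+_ length-V length-X)) few
    }

  open PreyAssignment (prey-assignment admissible)

  Hunts : Fin N → Fin N → Set
  Hunts x z = Any (λ p → Incident x (proj₁ p) × proj₂ p ≡ z) assignment

  Joins : Fin N → Fin N → Set
  Joins x z = ∃₂ λ a i → x ≡ old a × z ≡ clique i × T (lookup fam i a)

  hunts? : ∀ x z → Dec (Hunts x z)
  hunts? x z = any? (λ p → incident? x (proj₁ p) ×-dec (proj₂ p Finₚ.≟ z)) assignment

  joins? : ∀ x z → Dec (Joins x z)
  joins? x z = Finₚ.any? λ a → Finₚ.any? λ i →
                 (x Finₚ.≟ old a) ×-dec (z Finₚ.≟ clique i) ×-dec T? (lookup fam i a)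

  D : Digraph N
  D x z = ⌊ hunts? x z ⊎-dec joins? x z ⌋

  hunt-arc : ∀ {x e z} → (e , z) ∈ assignment → Incident x e → Arc D x z
  hunt-arc p∈ x∈e = fromWitness (inj₁ (lose p∈ (x∈e , refl)))

  join-arc : ∀ {a} i → T (lookup fam i a) → Arc D (old a) (clique i)
  join-arc {a} i a∈Cᵢ = fromWitness (inj₂ (a , i , refl , refl , a∈Cᵢ))

  hunted-prey : ∀ {x z} → Hunts x z → z ∈ V ++ X
  hunted-prey hunts with _ , p∈ , _ , refl ← find hunts = prey-available p∈

  top : ℕ
  top = suc (sum (map rank V))

  height : Fin N → ℕ
  height v with v ∈? (V ++ X)
  ... | yes _ = rank v
  ... | no _  = top

  height-prey : ∀ {v} → v ∈ V ++ X → height v ≡ rank v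
  height-prey {v} v∈ with v ∈? (V ++ X)
  ... | yes _ = refl
  ... | no v∉ = contradiction v∈ v∉

  height-clique : ∀ i → height (clique i) ≡ top
  height-clique i with clique i ∈? (V ++ X)
  ... | yes c∈ = contradiction c∈ (clique∉VX i)
  ... | no _   = refl

  climbs : ∀ {x z} → Arc D x z → height x < height z
  climbs xz with toWitness xz
  ... | inj₁ hunts with _ , p∈ , x∈e , refl ← find hunts =
    subst₂ _<_ (sym (height-prey (∈-++⁺ˡ (ends-in-V (edge-in-L p∈) x∈e))))
               (sym (height-prey (prey-available p∈)))
               (rank-increases p∈ x∈e)
  ... | inj₂ (a , i , refl , refl , _) =
    subst₂ _<_ (sym (height-prey (∈-++⁺ˡ (old∈V a)))) (sym (height-clique i))
               (s≤s (∈⇒≤sum rank (old∈V a)))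

  ends-adjacent : ∀ {x y e} → e ∈ L → Incident x e → Incident y e → x ≢ y →
                  T (addIsolated G (t + K) x y)
  ends-adjacent e∈L x∈e y∈e x≢y with L⁻ e∈L
  ends-adjacent _ (inj₁ refl) (inj₁ refl) x≢y | _ , _ , _ , refl = contradiction refl x≢y
  ends-adjacent _ (inj₂ refl) (inj₂ refl) x≢y | _ , _ , _ , refl = contradiction refl x≢y
  ends-adjacent _ (inj₁ refl) (inj₂ refl) _   | a , b , ab , refl =
    subst T (sym (addIsolated-↑ˡ G (t + K) a b)) ab
  ends-adjacent _ (inj₂ refl) (inj₁ refl) _   | a , b , ab , refl =
    subst T (sym (addIsolated-↑ˡ G (t + K) b a)) (subst T (Graph.sym G a b) ab)

  clique-adjacent : ∀ i {a b} → T (lookup fam i a) → T (lookup fam i b) → old a ≢ old b →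
                    T (addIsolated G (t + K) (old a) (old b))
  clique-adjacent i {a} {b} a∈Cᵢ b∈Cᵢ a≢b = subst T (sym (addIsolated-↑ˡ G (t + K) a b))
    (proj₁ cover (lookup fam i) (∈-lookup i) a b a∈Cᵢ b∈Cᵢ (a≢b ∘ cong old))

  via-clique : ∀ {a b C} → C ∈ fam → T (C a) → T (C b) →
               ∃ λ z → Arc D (old a) z × Arc D (old b) z
  via-clique {a} {b} C∈ a∈C b∈C =
    clique i , join-arc i (subst (λ C → T (C a)) C≡Cᵢ a∈C)
             , join-arc i (subst (λ C → T (C b)) C≡Cᵢ b∈C)
    where
    i : Fin t
    i = Any.index C∈
    C≡Cᵢ : _ ≡ lookup fam i
    C≡Cᵢ = Anyₚ.lookup-index C∈

  via-prey : ∀ {x y e} → e ∈ L → Incident x e → Incident y e → ∃ λ z → Arc D x z × Arc D y z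
  via-prey e∈L x∈e y∈e with z , p∈ ← edge-has-prey e∈L =
    z , hunt-arc p∈ x∈e , hunt-arc p∈ y∈e

  common-prey : ∀ {x y} → T (addIsolated G (t + K) x y) → ∃ λ z → Arc D x z × Arc D y z
  common-prey {x} {y} xy with a , b , refl , refl , ab ← addIsolated-edge G (t + K) x y xy
                         with triB G a b in triangle
  ... | true  with _ , C∈ , a∈C , b∈C ← proj₂ cover a b ab (in-triangle ab triangle)
              = via-clique C∈ a∈C b∈C
  ... | false with Ebar-complete ab triangle
  ...   | inj₁ ab∈ = via-prey (∈-map⁺ (Product.map old old) ab∈) (inj₁ refl) (inj₂ refl)
  ...   | inj₂ ba∈ = via-prey (∈-map⁺ (Product.map old old) ba∈) (inj₂ refl) (inj₁ refl)

  -- Conversely, distinct vertices with a common prey are adjacent: each prey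
  -- belongs to a single edge, and clique vertices are never preys of edges.
  shared-prey-adjacent : ∀ {x y z} → x ≢ y → Arc D x z → Arc D y z → T (addIsolated G (t + K) x y)
  shared-prey-adjacent x≢y xz yz with toWitness xz | toWitness yz
  ... | inj₁ x-hunts | inj₁ y-hunts
      with _ , p∈ , x∈e , refl ← find x-hunts
      with _ , p′∈ , y∈e′ , refl ← find y-hunts
      with refl ← unique-map-injective proj₂ preys-unique p∈ p′∈ refl
      = ends-adjacent (edge-in-L p∈) x∈e y∈e′ x≢y
  ... | inj₂ (a , i , refl , refl , a∈Cᵢ) | inj₂ (b , i′ , refl , z≡ , b∈Cᵢ′)
      with refl ← Finₚ.↑ˡ-injective K i i′ (Finₚ.↑ʳ-injective (n G) _ _ z≡)
      = clique-adjacent i a∈Cᵢ b∈Cᵢ′ x≢y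
  ... | inj₁ x-hunts | inj₂ (_ , i , _ , refl , _) = ⊥-elim (clique∉VX i (hunted-prey x-hunts))
  ... | inj₂ (_ , i , _ , refl , _) | inj₁ y-hunts = ⊥-elim (clique∉VX i (hunted-prey y-hunts))

  realizable : CompetitionRealizable G (t + K)
  realizable = D , ranked⇒acyclic D height climbs ,
               λ x y x≢y → mk⇔ common-prey (λ (_ , xz , yz) → shared-prey-adjacent x≢y xz yz)

theorem-room : ∀ n m → 0 < m →
               1 ≤ (1 ⊓ m) ⊔ ((m + 2) ∸ n) × m + 2 ≤ n + ((1 ⊓ m) ⊔ ((m + 2) ∸ n))
theorem-room n (suc m) _ =
  m≤m⊔n 1 (suc m + 2 ∸ n) , ≤-trans (m≤n+m∸n (suc m + 2) n) (+-monoʳ-≤ n (m≤n⊔m 1 _))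

mainTheorem9 : (G : Graph) (k t : ℕ) →
    IsCompetitionNumber G k →
    IsThetaE G (ETriangle G) t →
    k ≤ t + ((1 ⊓ countEbar G) ⊔ ((countEbar G + 2) ∸ n G))
mainTheorem9 G k t (_ , least) ((fam , cover , refl) , _) =
  least (length fam + K) (Realization.realizable G fam cover K (theorem-room (n G) (countEbar G)))
  where
  K : ℕ
  K = (1 ⊓ countEbar G) ⊔ ((countEbar G + 2) ∸ n G)
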